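{- For every integer $m\geq 3$, the graph $C_m[4]$ has a $C_4$-factorization.
   Context: For a graph $G$ and integer $k\geq 1$, $G[k]$ denotes the graph with vertex set $V(G)\times\{0,1,\dots,k-1\}$ in which $(u,i)$ and $(w,j)$ are adjacent if and only if $uw\in E(G)$ (lexicographic product with the empty graph on $k$ vertices). $C_m$ is the cycle of length $m$. A $C_\ell$-factor of a graph is a spanning subgraph that is a vertex-disjoint union of $\ell$-cycles; a $C_\ell$-factorization is a partition of the edge set into $C_\ell$-factors. -}

module Defs where

open import Data.Nat using (ℕ; zero; suc; _≤_)
open import Data.Fin using (Fin; toℕ) renaming (zero to f0; suc to fs)
open import Data.Product using (Σ; _×_; _,_; ∃; ∃-syntax; proj₁; proj₂)
open import Data.Sum using (_⊎_)
open import Relation.Binary.PropositionalEquality using (_≡_)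
open import Function.Definitions using (Injective)

-- The cycle C_m has vertex set Fin m; i and j adjacent iff j = i+1 (mod m)
-- or i = j+1 (mod m).  (For m ≥ 3 this is the m-cycle.)
CycSucc : (m : ℕ) → Fin m → Fin m → Set
CycSucc m i j = (suc (toℕ i) ≡ toℕ j) ⊎ (suc (toℕ i) ≡ m × toℕ j ≡ 0)

CycAdj : (m : ℕ) → Fin m → Fin m → Set
CycAdj m i j = CycSucc m i j ⊎ CycSucc m j i

-- The lexicographic product G[k] with G = C_m, k = 4:
-- vertices V(C_m) × {0,1,2,3}; (u,i) ~ (w,j) iff u ~ w in C_m.
V : ℕ → Set
V m = Fin m × Fin 4

Adj : (m : ℕ) → V m → V m → Set
Adj m (u , _) (w , _) = CycAdj m u w

next4 : Fin 4 → Fin 4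
next4 f0 = fs f0
next4 (fs f0) = fs (fs f0)
next4 (fs (fs f0)) = fs (fs (fs f0))
next4 (fs (fs (fs f0))) = f0

record Cycle4 (m : ℕ) : Set where
  field
    vtx      : Fin 4 → V m
    distinct : Injective _≡_ _≡_ vtx
    edges    : (p : Fin 4) → Adj m (vtx p) (vtx (next4 p))
open Cycle4 public

OnCycle : {m : ℕ} → V m → Cycle4 m → Set
OnCycle x C = ∃[ p ] vtx C p ≡ x

EdgeOf : {m : ℕ} → V m → V m → Cycle4 m → Set
EdgeOf x y C = ∃[ p ] ((vtx C p ≡ x × vtx C (next4 p) ≡ y)
                     ⊎ (vtx C p ≡ y × vtx C (next4 p) ≡ x))

record C4Factor (m : ℕ) : Set where
  field
    size   : ℕ
    cycles : Fin size → Cycle4 m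
    cover  : (x : V m) → Σ (Fin size) λ c → OnCycle x (cycles c)
                           × ((c' : Fin size) → OnCycle x (cycles c') → c' ≡ c)
open C4Factor public

-- A C_4-factorization of C_m[4]: a family of C_4-factors partitioning the
-- edge set: every edge lies in exactly one cycle of exactly one factor.
-- (Every cycle edge is a graph edge by definition of Cycle4.)
record C4Factorization (m : ℕ) : Set where
  field
    nfactors : ℕ
    factor   : Fin nfactors → C4Factor m
    partition : (x y : V m) → Adj m x y →
      Σ (Σ (Fin nfactors) λ f → Fin (size (factor f))) λ fc →
          EdgeOf x y (cycles (factor (proj₁ fc)) (proj₂ fc))
        × ((fc' : Σ (Fin nfactors) λ f → Fin (size (factor f))) →
            EdgeOf x y (cycles (factor (proj₁ fc')) (proj₂ fc')) → fc' ≡ fc)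

-- Between consecutive layers g and g+1 of C_m[4] lie the 16 edges of a K₄,₄.
-- Splitting each layer into two blocks of size two cuts them into four 4-cycles
-- ("squares"), one for each pair of blocks; give the four squares of every gap
-- four different colours.  Every edge then lies on exactly one square, and the
-- squares of one colour form a C₄-factor precisely when, at each layer, the two
-- squares of that colour meeting there use complementary blocks of it.  So a
-- factorization is a choice, for each gap, of a bijection between colours and
-- pairs of blocks, subject to this local condition between consecutive gaps:
-- two alternating bijections close up around an even cycle, and on an odd
-- cycle two further bijections make up for the parity.
module Submission where

open import Defs
open import Data.Bool using (Bool; true; false; not; _xor_; _≟_)
open import Data.Bool.Properties using (not-involutive; not-¬; ¬-not)
open import Data.Empty using (⊥-elim)
open import Data.Fin as Fin using (Fin; toℕ; fromℕ; fromℕ<; inject₁)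
open import Data.Fin.Patterns using (0F; 1F; 2F; 3F)
open import Data.Fin.Properties using (toℕ-injective; toℕ-fromℕ; toℕ-fromℕ<; toℕ-inject₁; toℕ<n)
open import Data.Nat using (ℕ; zero; suc; _+_; _≤_; _<?_; s≤s)
open import Data.Nat.Properties
  using (≤-antisym; ≤-reflexive; ≮⇒≥; <-asym; <-irrefl; suc-injective; 0≢1+n; 1+n≢n)
open import Data.Product using (Σ-syntax; _×_; _,_; proj₁; proj₂; uncurry)
open import Data.Sum using (_⊎_; inj₁; inj₂; swap)
open import Function using (_↔_; Inverse; mk↔ₛ′; _∘_; id)
open import Function.Construct.Composition using (_↔-∘_)
open import Function.Definitions using (Injective)
open import Relation.Nullary using (¬_; yes; no)
open import Relation.Binary.PropositionalEquality
open ≡-Reasoning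
open Inverse using (to; from; strictlyInverseˡ; strictlyInverseʳ)

next : ∀ {m} → Fin m → Fin m
next {suc m} i with suc (toℕ i) <? suc m
... | yes i+1<m = fromℕ< i+1<m
... | no _      = 0F

CycSucc-next : ∀ {m} (i : Fin m) → CycSucc m i (next i)
CycSucc-next {suc m} i with suc (toℕ i) <? suc m
... | yes i+1<m = inj₁ (sym (toℕ-fromℕ< i+1<m))
... | no i+1≮m  = inj₂ (≤-antisym (toℕ<n i) (≮⇒≥ i+1≮m) , refl)

prev : ∀ {m} → Fin m → Fin m
prev {suc m} 0F          = fromℕ m
prev {suc m} (Fin.suc i) = inject₁ i

CycSucc-prev : ∀ {m} (i : Fin m) → CycSucc m (prev i) i
CycSucc-prev {suc m} 0F          = inj₂ (cong suc (toℕ-fromℕ m) , refl)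
CycSucc-prev {suc m} (Fin.suc i) = inj₁ (cong suc (toℕ-inject₁ i))

CycSucc-functional : ∀ {m} {i j k : Fin m} → CycSucc m i j → CycSucc m i k → j ≡ k
CycSucc-functional         (inj₁ p)       (inj₁ q)       = toℕ-injective (trans (sym p) q)
CycSucc-functional {j = j} (inj₁ p)       (inj₂ (q , _)) = ⊥-elim (<-irrefl (trans (sym p) q) (toℕ<n j))
CycSucc-functional {k = k} (inj₂ (p , _)) (inj₁ q)       = ⊥-elim (<-irrefl (trans (sym q) p) (toℕ<n k))
CycSucc-functional         (inj₂ (_ , p)) (inj₂ (_ , q)) = toℕ-injective (trans p (sym q))

CycSucc-injective : ∀ {m} {i j k : Fin m} → CycSucc m i k → CycSucc m j k → i ≡ j
CycSucc-injective (inj₁ p)       (inj₁ q)       = toℕ-injective (suc-injective (trans p (sym q)))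
CycSucc-injective (inj₁ p)       (inj₂ (_ , q)) = ⊥-elim (0≢1+n (trans (sym q) (sym p)))
CycSucc-injective (inj₂ (_ , p)) (inj₁ q)       = ⊥-elim (0≢1+n (trans (sym p) (sym q)))
CycSucc-injective (inj₂ (p , _)) (inj₂ (q , _)) = toℕ-injective (suc-injective (trans p (sym q)))

next-prev : ∀ {m} (i : Fin m) → next (prev i) ≡ i
next-prev i = CycSucc-functional (CycSucc-next (prev i)) (CycSucc-prev i)

next-injective : ∀ {m} → Injective _≡_ _≡_ (next {m})
next-injective {x = i} {j} eq =
  CycSucc-injective (CycSucc-next i) (subst (CycSucc _ j) (sym eq) (CycSucc-next j))

CycSucc-irreflexive : ∀ {n} {i : Fin (2 + n)} → ¬ CycSucc (2 + n) i i
CycSucc-irreflexive (inj₁ p)       = 1+n≢n p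
CycSucc-irreflexive (inj₂ (p , z)) = 0≢1+n (suc-injective (trans (cong suc (sym z)) p))

private
  step-then-wrap : ∀ {n} {i j : Fin (3 + n)} →
                   suc (toℕ i) ≡ toℕ j → suc (toℕ j) ≡ 3 + n → ¬ toℕ i ≡ 0
  step-then-wrap p q z =
    0≢1+n (suc-injective (suc-injective (trans (cong (suc ∘ suc) (sym z)) (trans (cong suc p) q))))

CycSucc-asymmetric : ∀ {n} {i j : Fin (3 + n)} → CycSucc (3 + n) i j → ¬ CycSucc (3 + n) j i
CycSucc-asymmetric (inj₁ p)       (inj₁ q)       = <-asym (≤-reflexive p) (≤-reflexive q)
CycSucc-asymmetric (inj₁ p)       (inj₂ (q , z)) = step-then-wrap p q z
CycSucc-asymmetric (inj₂ (q , z)) (inj₁ p)       = step-then-wrap p q z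
CycSucc-asymmetric (inj₂ (p , _)) (inj₂ (_ , z)) =
  0≢1+n (suc-injective (trans (cong suc (sym z)) p))

EdgeOf-sym : ∀ {m} {x y : V m} (C : Cycle4 m) → EdgeOf x y C → EdgeOf y x C
EdgeOf-sym _ (p , e) = p , swap e

Bool² : Set
Bool² = Bool × Bool

Bool²-ind : {P : Bool² → Set} →
            P (false , false) → P (false , true) → P (true , false) → P (true , true) →
            ∀ x → P x
Bool²-ind ff _  _  _  (false , false) = ff
Bool²-ind _  ft _  _  (false , true)  = ft
Bool²-ind _  _  tf _  (true  , false) = tf
Bool²-ind _  _  _  tt (true  , true)  = tt

label : Bool → Bool → Fin 4
label false false = 0F
label false true  = 1F
label true  false = 2F
label true  true  = 3F

block : Fin 4 → Bool
block 0F = false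
block 1F = false
block 2F = true
block 3F = true

bit : Fin 4 → Bool
bit 0F = false
bit 1F = true
bit 2F = false
bit 3F = true

label-block-bit : ∀ s → label (block s) (bit s) ≡ s
label-block-bit 0F = refl
label-block-bit 1F = refl
label-block-bit 2F = refl
label-block-bit 3F = refl

halves : Fin 4 ↔ Bool²
halves = mk↔ₛ′ (λ s → block s , bit s) (uncurry label) (Bool²-ind refl refl refl refl) label-block-bit

block-label : ∀ a e → block (label a e) ≡ a
block-label a e = cong proj₁ (strictlyInverseˡ halves (a , e))

bit-label : ∀ a e → bit (label a e) ≡ e
bit-label a e = cong proj₂ (strictlyInverseˡ halves (a , e))

InBlock : ∀ {m} → Fin m → Bool → V m → Set
InBlock g a (i , s) = i ≡ g × block s ≡ a

InBlock-label : ∀ {m} (g : Fin m) a e → InBlock g a (g , label a e)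
InBlock-label g a e = refl , block-label a e

-- The complete bipartite graph between block a of layer g and block b of
-- layer next g, traversed as a 4-cycle.
square : ∀ {n} → Fin (2 + n) → Bool → Bool → Cycle4 (2 + n)
square {n} g a b = record { vtx = corner ; distinct = corner-injective ; edges = corner-edges }
  where
  side : Bool → Fin (2 + n)
  side false = g
  side true  = next g

  blockOn : Bool → Bool
  blockOn false = a
  blockOn true  = b

  -- Corner p lies on side (bit p), so consecutive corners alternate between the two layers.
  corner : Fin 4 → V (2 + n)
  corner p = side (bit p) , label (blockOn (bit p)) (block p)

  side-injective : Injective _≡_ _≡_ side
  side-injective {false} {false} _ = refl
  side-injective {false} {true}  e = ⊥-elim (CycSucc-irreflexive (subst (CycSucc _ g) (sym e) (CycSucc-next g)))
  side-injective {true}  {false} e = ⊥-elim (CycSucc-irreflexive (subst (CycSucc _ g) e (CycSucc-next g)))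
  side-injective {true}  {true}  _ = refl

  corner-injective : Injective _≡_ _≡_ corner
  corner-injective {p} {q} eq = begin
    p                        ≡⟨ label-block-bit p ⟨
    label (block p) (bit p)  ≡⟨ cong₂ label same-rank same-side ⟩
    label (block q) (bit q)  ≡⟨ label-block-bit q ⟩
    q                        ∎
    where
    same-side : bit p ≡ bit q
    same-side = side-injective (cong proj₁ eq)

    same-rank : block p ≡ block q
    same-rank = begin
      block p                                  ≡⟨ bit-label _ (block p) ⟨
      bit (label (blockOn (bit p)) (block p))  ≡⟨ cong (bit ∘ proj₂) eq ⟩
      bit (label (blockOn (bit q)) (block q))  ≡⟨ bit-label _ (block q) ⟩
      block q                                  ∎

  corner-edges : ∀ p → Adj (2 + n) (corner p) (corner (next4 p))
  corner-edges 0F = inj₁ (CycSucc-next g)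
  corner-edges 1F = inj₂ (CycSucc-next g)
  corner-edges 2F = inj₁ (CycSucc-next g)
  corner-edges 3F = inj₂ (CycSucc-next g)

module _ {n : ℕ} {g : Fin (2 + n)} {a b : Bool} where

  square-vertex : ∀ {x} → OnCycle x (square g a b) → InBlock g a x ⊎ InBlock (next g) b x
  square-vertex (0F , refl) = inj₁ (InBlock-label g a false)
  square-vertex (1F , refl) = inj₂ (InBlock-label (next g) b false)
  square-vertex (2F , refl) = inj₁ (InBlock-label g a true)
  square-vertex (3F , refl) = inj₂ (InBlock-label (next g) b true)

  lower-on-square : ∀ {x} → InBlock g a x → OnCycle x (square g a b)
  lower-on-square {_ , 0F} (refl , refl) = 0F , refl
  lower-on-square {_ , 1F} (refl , refl) = 2F , refl
  lower-on-square {_ , 2F} (refl , refl) = 0F , refl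
  lower-on-square {_ , 3F} (refl , refl) = 2F , refl

  upper-on-square : ∀ {x} → InBlock (next g) b x → OnCycle x (square g a b)
  upper-on-square {_ , 0F} (refl , refl) = 1F , refl
  upper-on-square {_ , 1F} (refl , refl) = 3F , refl
  upper-on-square {_ , 2F} (refl , refl) = 1F , refl
  upper-on-square {_ , 3F} (refl , refl) = 3F , refl

  Crossing : V (2 + n) → V (2 + n) → Set
  Crossing x y = InBlock g a x × InBlock (next g) b y

  square-edge : ∀ e e' → EdgeOf (g , label a e) (next g , label b e') (square g a b)
  square-edge false false = 0F , inj₁ (refl , refl)
  square-edge true  false = 1F , inj₂ (refl , refl)
  square-edge true  true  = 2F , inj₁ (refl , refl)
  square-edge false true  = 3F , inj₂ (refl , refl)

  crossing-edge : ∀ {x y} → Crossing x y → EdgeOf x y (square g a b)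
  crossing-edge {_ , s} {_ , t} ((refl , refl) , (refl , refl)) =
    subst₂ (λ s t → EdgeOf (g , s) (next g , t) (square g a b))
      (label-block-bit s) (label-block-bit t) (square-edge (bit s) (bit t))

  corner-crossing : ∀ p → let v = vtx (square g a b) in
                    Crossing (v p) (v (next4 p)) ⊎ Crossing (v (next4 p)) (v p)
  corner-crossing 0F = inj₁ (InBlock-label g a false , InBlock-label (next g) b false)
  corner-crossing 1F = inj₂ (InBlock-label g a true  , InBlock-label (next g) b false)
  corner-crossing 2F = inj₁ (InBlock-label g a true  , InBlock-label (next g) b true)
  corner-crossing 3F = inj₂ (InBlock-label g a false , InBlock-label (next g) b true)

  edge-crossing : ∀ {x y} → EdgeOf x y (square g a b) → Crossing x y ⊎ Crossing y x
  edge-crossing (p , inj₁ (refl , refl)) = corner-crossing p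
  edge-crossing (p , inj₂ (refl , refl)) = swap (corner-crossing p)

_⇝_ : ∀ {A : Set} → A ↔ Bool² → A ↔ Bool² → Set
σ ⇝ τ = ∀ c → proj₁ (to τ c) ≡ not (proj₂ (to σ c))

⇝-∘ : ∀ {A B : Set} (ι : A ↔ B) (σ τ : B ↔ Bool²) → σ ⇝ τ → (σ ↔-∘ ι) ⇝ (τ ↔-∘ ι)
⇝-∘ ι _ _ σ⇝τ c = σ⇝τ (to ι c)

-- blocks g sends colour c to (a , b) when the edges of colour c between
-- layers g and next g form square g a b.
record Schedule (m : ℕ) : Set where
  field
    blocks     : Fin m → Fin 4 ↔ Bool²
    compatible : ∀ g → blocks g ⇝ blocks (next g)

module _ {n : ℕ} (S : Schedule (3 + n)) where
  open Schedule S

  lower upper : Fin (3 + n) → Fin 4 → Bool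
  lower g c = proj₁ (to (blocks g) c)
  upper g c = proj₂ (to (blocks g) c)

  cycle : Fin 4 → Fin (3 + n) → Cycle4 (3 + n)
  cycle c g = square g (lower g c) (upper g c)

  lower-upper-disjoint : ∀ {c g g' x} → InBlock g (lower g c) x → ¬ InBlock (next g') (upper g' c) x
  lower-upper-disjoint {c} {g} {g'} {i , s} (i≡g , s-low) (i≡g'+1 , s-up) = not-¬ refl (begin
    block s            ≡⟨ s-low ⟩
    lower g c          ≡⟨ cong (λ j → lower j c) (trans (sym i≡g) i≡g'+1) ⟩
    lower (next g') c  ≡⟨ compatible g' c ⟩
    not (upper g' c)   ≡⟨ cong not s-up ⟨
    not (block s)      ∎)

  cycle-covering : ∀ c x → Σ[ g ∈ Fin (3 + n) ] OnCycle x (cycle c g)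
  cycle-covering c (i , s) with block s ≟ lower i c
  ... | yes s-low  = i , lower-on-square (refl , s-low)
  ... | no  s-high = prev i , upper-on-square (sym (next-prev i) , s-up)
    where
    s-up : block s ≡ upper (prev i) c
    s-up = begin
      block s                        ≡⟨ ¬-not s-high ⟩
      not (lower i c)                ≡⟨ cong (λ j → not (lower j c)) (next-prev i) ⟨
      not (lower (next (prev i)) c)  ≡⟨ cong not (compatible (prev i) c) ⟩
      not (not (upper (prev i) c))   ≡⟨ not-involutive _ ⟩
      upper (prev i) c               ∎

  cycles-disjoint : ∀ c {x g g'} → OnCycle x (cycle c g) → OnCycle x (cycle c g') → g' ≡ g
  cycles-disjoint c on on' with square-vertex on | square-vertex on'
  ... | inj₁ (i≡g , _)   | inj₁ (i≡g' , _)   = trans (sym i≡g') i≡g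
  ... | inj₂ (i≡g+1 , _) | inj₂ (i≡g'+1 , _) = next-injective (trans (sym i≡g'+1) i≡g+1)
  ... | inj₁ low         | inj₂ up           = ⊥-elim (lower-upper-disjoint low up)
  ... | inj₂ up          | inj₁ low          = ⊥-elim (lower-upper-disjoint low up)

  factor : Fin 4 → C4Factor (3 + n)
  factor c = record
    { size   = 3 + n
    ; cycles = cycle c
    ; cover  = λ x → let (g , on) = cycle-covering c x in
                     g , on , λ g' on' → cycles-disjoint c on on'
    }

  EdgeOnUniqueCycle : V (3 + n) → V (3 + n) → Set
  EdgeOnUniqueCycle x y =
    Σ[ cg ∈ Fin 4 × Fin (3 + n) ] EdgeOf x y (uncurry cycle cg)
      × (∀ cg' → EdgeOf x y (uncurry cycle cg') → cg' ≡ cg)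

  forward-edge-on-unique-cycle : ∀ {u w} s t → CycSucc (3 + n) u w → EdgeOnUniqueCycle (u , s) (w , t)
  forward-edge-on-unique-cycle {u} {w} s t u→w = (c , u) , crossing-edge crossing , unique
    where
    c : Fin 4
    c = from (blocks u) (block s , block t)

    blocks-c : to (blocks u) c ≡ (block s , block t)
    blocks-c = strictlyInverseˡ (blocks u) _

    crossing : Crossing {g = u} {lower u c} {upper u c} (u , s) (w , t)
    crossing = (refl , cong proj₁ (sym blocks-c))
             , (CycSucc-functional u→w (CycSucc-next u) , cong proj₂ (sym blocks-c))

    unique : ∀ cg' → EdgeOf (u , s) (w , t) (uncurry cycle cg') → cg' ≡ (c , u)
    unique (c' , g') e with edge-crossing e
    ... | inj₁ ((refl , s-low) , (_ , t-up)) = cong (_, u) (begin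
      c'                                  ≡⟨ strictlyInverseʳ (blocks u) c' ⟨
      from (blocks u) (to (blocks u) c')  ≡⟨ cong (from (blocks u)) (cong₂ _,_ s-low t-up) ⟨
      c                                   ∎)
    ... | inj₂ ((w≡g' , _) , (u≡g'+1 , _)) =
      ⊥-elim (CycSucc-asymmetric (CycSucc-next g') (subst₂ (CycSucc _) u≡g'+1 w≡g' u→w))

  factorization : C4Factorization (3 + n)
  factorization = record { nfactors = 4 ; factor = factor ; partition = partition }
    where
    partition : ∀ x y → Adj (3 + n) x y → EdgeOnUniqueCycle x y
    partition (u , s) (w , t) (inj₁ u→w) = forward-edge-on-unique-cycle s t u→w
    partition (u , s) (w , t) (inj₂ w→u) =
      let (cg , e , unique) = forward-edge-on-unique-cycle t s w→u in
      cg , EdgeOf-sym (uncurry cycle cg) e , λ cg' → unique cg' ∘ EdgeOf-sym (uncurry cycle cg')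

straight crossed twist twist′ : Bool² ↔ Bool²
straight = mk↔ₛ′ id id (λ _ → refl) (λ _ → refl)
crossed  = mk↔ₛ′ (λ (x , y) → not y , not x) (λ (a , b) → not b , not a)
                 (Bool²-ind refl refl refl refl) (Bool²-ind refl refl refl refl)
twist    = mk↔ₛ′ (λ (x , y) → not y , x xor y) (λ (a , b) → b xor not a , not a)
                 (Bool²-ind refl refl refl refl) (Bool²-ind refl refl refl refl)
twist′   = mk↔ₛ′ (λ (x , y) → not (x xor y) , not x) (λ (a , b) → not b , a xor b)
                 (Bool²-ind refl refl refl refl) (Bool²-ind refl refl refl refl)

straight⇝crossed : straight ⇝ crossed
straight⇝crossed _ = refl

crossed⇝straight : crossed ⇝ straight
crossed⇝straight = Bool²-ind refl refl refl refl

straight⇝twist : straight ⇝ twist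
straight⇝twist _ = refl

twist⇝twist′ : twist ⇝ twist′
twist⇝twist′ _ = refl

twist′⇝straight : twist′ ⇝ straight
twist′⇝straight = Bool²-ind refl refl refl refl

alternating : ℕ → Bool² ↔ Bool²
alternating zero          = straight
alternating (suc zero)    = crossed
alternating (suc (suc k)) = alternating k

odd : ℕ → Bool
odd zero          = false
odd (suc zero)    = true
odd (suc (suc k)) = odd k

-- The alternation straight, crossed, straight, … closes up only after an even
-- number of gaps; on an odd cycle gaps 0 and 1 take the detour twist, twist′.
gapPattern : Bool → ℕ → Bool² ↔ Bool²
gapPattern _     (suc (suc k)) = alternating k
gapPattern false zero          = straight
gapPattern false (suc zero)    = crossed
gapPattern true  zero          = twist
gapPattern true  (suc zero)    = twist′

alternating-⇝ : ∀ k → alternating k ⇝ alternating (suc k)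
alternating-⇝ zero          = straight⇝crossed
alternating-⇝ (suc zero)    = crossed⇝straight
alternating-⇝ (suc (suc k)) = alternating-⇝ k

gapPattern-⇝ : ∀ o k → gapPattern o k ⇝ gapPattern o (suc k)
gapPattern-⇝ _     (suc (suc k)) = alternating-⇝ k
gapPattern-⇝ false zero          = straight⇝crossed
gapPattern-⇝ false (suc zero)    = crossed⇝straight
gapPattern-⇝ true  zero          = twist⇝twist′
gapPattern-⇝ true  (suc zero)    = twist′⇝straight

gapPattern-wrap : ∀ n → gapPattern (odd (3 + n)) (2 + n) ⇝ gapPattern (odd (3 + n)) 0
gapPattern-wrap zero          = straight⇝twist
gapPattern-wrap (suc zero)    = crossed⇝straight
gapPattern-wrap (suc (suc n)) = gapPattern-wrap n

schedule : ∀ n → Schedule (3 + n)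
schedule n = record { blocks = blocks ; compatible = compatible }
  where
  patternAt : Fin (3 + n) → Bool² ↔ Bool²
  patternAt g = gapPattern (odd (3 + n)) (toℕ g)

  blocks : Fin (3 + n) → Fin 4 ↔ Bool²
  blocks g = patternAt g ↔-∘ halves

  gapPattern-next : ∀ g → patternAt g ⇝ patternAt (next g)
  gapPattern-next g with CycSucc-next g
  ... | inj₁ step =
    subst (λ k → patternAt g ⇝ gapPattern _ k) step (gapPattern-⇝ _ (toℕ g))
  ... | inj₂ (wrap , next≡0) =
    subst₂ (λ k k′ → gapPattern _ k ⇝ gapPattern _ k′)
      (sym (suc-injective wrap)) (sym next≡0) (gapPattern-wrap n)

  compatible : ∀ g → blocks g ⇝ blocks (next g)
  compatible g = ⇝-∘ halves (patternAt g) (patternAt (next g)) (gapPattern-next g)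

lemma5 : (m : ℕ) → 3 ≤ m → C4Factorization m
lemma5 (suc (suc (suc n))) _ = factorization (schedule n)
lemma5 0 ()
lemma5 1 (s≤s ())
lemma5 2 (s≤s (s≤s ()))
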